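{- For an integer $s\ge2$ let $h_s(x)=x/(1-x)^s$. Then for every $y\in\mathbb{K}[[x]]$, $$\mathcal{D}_{h_s}(y)=\sum_{k=1}^{s-1}\frac{1}{k!}\binom{s-2}{k-1}x^{k-1}y^{(k)},$$ where $y^{(k)}$ is the usual $k$-th derivative of $y$.
   Context: $\mathbb{K}$ is a field of characteristic zero. For $h(x)=\sum_{k\ge1}h_kx^k$ with all $h_k\ne0$, the $h$-derivative is $\mathcal{D}_h\big(\sum_{k\ge0}s_kx^k\big)=\sum_{k\ge1}h_ks_kx^{k-1}$. The usual derivative of formal power series is $\big(\sum_k s_kx^k\big)'=\sum_{k\ge1}ks_kx^{k-1}$. -}

module Defs where

open import Level using (Level; _⊔_) renaming (suc to lsuc)
open import Data.Nat using (ℕ; zero; suc; _∸_; _!)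
open import Data.Nat.Combinatorics using (_C_)
open import Relation.Nullary using (¬_)
open import Algebra.Bundles using (CommutativeRing)
import Algebra.Bundles
import Algebra.Definitions.RawSemiring as RS

-- A field: a commutative ring with 0 ≠ 1 in which every nonzero element
-- has a multiplicative inverse (given by a total function _⁻¹, whose value
-- at 0 is irrelevant).
record Field (c ℓ : Level) : Set (lsuc (c ⊔ ℓ)) where
  field
    commutativeRing : CommutativeRing c ℓ
  open CommutativeRing commutativeRing public
  field
    _⁻¹     : Carrier → Carrier
    0≉1     : ¬ (0# ≈ 1#)
    inverse : ∀ x → ¬ (x ≈ 0#) → x * (x ⁻¹) ≈ 1#
  open RS (Algebra.Bundles.Semiring.rawSemiring semiring) public using (_×_)

module _ {c ℓ : Level} (F : Field c ℓ) where
  open Field F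

  CharZero : Set ℓ
  CharZero = ∀ n → ¬ ((suc n × 1#) ≈ 0#)

  ι : ℕ → Carrier
  ι n = n × 1#

  sumTo : ℕ → (ℕ → Carrier) → Carrier
  sumTo zero    f = 0#
  sumTo (suc n) f = sumTo n f + f n

  FPS : Set c
  FPS = ℕ → Carrier

  _≈ₛ_ : FPS → FPS → Set ℓ
  f ≈ₛ g = ∀ n → f n ≈ g n

  _+ₛ_ : FPS → FPS → FPS
  (f +ₛ g) n = f n + g n

  _*ₛ_ : FPS → FPS → FPS
  (f *ₛ g) n = sumTo (suc n) (λ i → f i * g (n ∸ i))

  _·ₛ_ : Carrier → FPS → FPS
  (a ·ₛ f) n = a * f n

  zeroₛ : FPS
  zeroₛ _ = 0#

  oneₛ : FPS
  oneₛ zero    = 1#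
  oneₛ (suc _) = 0#

  Xₛ : FPS
  Xₛ zero          = 0#
  Xₛ (suc zero)    = 1#
  Xₛ (suc (suc _)) = 0#

  oneMinusX : FPS
  oneMinusX zero          = 1#
  oneMinusX (suc zero)    = - 1#
  oneMinusX (suc (suc _)) = 0#

  _^ₛ_ : FPS → ℕ → FPS
  f ^ₛ zero  = oneₛ
  f ^ₛ suc n = f *ₛ (f ^ₛ n)

  sumₛ : ℕ → (ℕ → FPS) → FPS
  sumₛ zero    G = zeroₛ
  sumₛ (suc n) G = sumₛ n G +ₛ G n

  deriv : FPS → FPS
  deriv f n = ι (suc n) * f (suc n)

  derivN : ℕ → FPS → FPS
  derivN zero    f = f
  derivN (suc k) f = deriv (derivN k f)

  hDeriv : FPS → FPS → FPS
  hDeriv h f n = h (suc n) * f (suc n)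

{-# OPTIONS --safe #-}

-- Multiplication by 1 - x is the backward difference Δ, which is injective on series, and by
-- Pascal's rule Δ lowers t in the series Σ C(n+t, t) x^(n+1) = x/(1-x)^(t+1); so (1-x)^s h = x
-- forces h_(n+1) = C(n+s-1, s-1). By the absorption identity y^(k) has coefficients
-- k! C(m+k, k) y_(m+k), so the coefficient of x^n on the right is Σ_j C(s-2, j) C(n+1, j+1) y_(n+1),
-- which Vandermonde's identity turns into C(n+s-1, s-1) y_(n+1) = h_(n+1) y_(n+1).
module Submission where

open import Defs
open import Level using (Level)
open import Data.Nat using (ℕ; zero; suc; _∸_; _≤_; _<_; _!; z≤n; s≤s; NonZero)
open import Data.Nat.Combinatorics
  using (_C_; nCn≡1; nC1≡n; nCk≡nC[n∸k]; k>n⇒nCk≡0; nCk+nC[k+1]≡[n+1]C[k+1])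
import Data.Nat as ℕ
import Data.Nat.Properties as ℕ
open import Data.Nat.GeneralisedArithmetic using (fold; iterate-is-fold)
open import Data.Maybe using (nothing)
open import Function using (_∘_; id)
import Relation.Binary.PropositionalEquality as ≡
open ≡ using (_≡_; cong; cong₂)

nC0≡1 : ∀ n → n C 0 ≡ 1
nC0≡1 n = ≡.trans (nCk≡nC[n∸k] {0} {n} z≤n) (nCn≡1 n)

module _ where
  open import Data.Nat using (_+_; _*_)
  open import Data.Nat.Properties
    using (+-assoc; *-assoc; *-comm; *-zeroʳ; *-identityˡ; *-identityʳ; *-distribˡ-+; *-commutativeSemigroup)
  open ≡.≡-Reasoning

  [k+1]*[n+1]C[k+1]≡[n+1]*nCk : ∀ n k → suc k * (suc n C suc k) ≡ suc n * (n C k)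
  [k+1]*[n+1]C[k+1]≡[n+1]*nCk zero    zero    = ≡.refl
  [k+1]*[n+1]C[k+1]≡[n+1]*nCk zero    (suc k) = *-zeroʳ (suc (suc k))
  [k+1]*[n+1]C[k+1]≡[n+1]*nCk (suc n) zero    = begin
    1 * (suc (suc n) C 1)  ≡⟨ *-identityˡ _ ⟩
    suc (suc n) C 1        ≡⟨ nC1≡n (suc (suc n)) ⟩
    suc (suc n)            ≡⟨ *-identityʳ (suc (suc n)) ⟨
    suc (suc n) * 1        ≡⟨ cong (suc (suc n) *_) (nC0≡1 (suc n)) ⟨
    suc (suc n) * (suc n C 0) ∎
  [k+1]*[n+1]C[k+1]≡[n+1]*nCk (suc n) (suc k) = begin
    suc K * (suc N C suc K)
      ≡⟨ cong (suc K *_) (nCk+nC[k+1]≡[n+1]C[k+1] N K) ⟨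
    suc K * (N C K + N C suc K)
      ≡⟨ *-distribˡ-+ (suc K) (N C K) (N C suc K) ⟩
    (N C K + K * (N C K)) + suc K * (N C suc K)
      ≡⟨ cong₂ (λ a b → (N C K + a) + b)
               ([k+1]*[n+1]C[k+1]≡[n+1]*nCk n k) ([k+1]*[n+1]C[k+1]≡[n+1]*nCk n K) ⟩
    (N C K + N * (n C k)) + N * (n C K)
      ≡⟨ +-assoc (N C K) _ _ ⟩
    N C K + (N * (n C k) + N * (n C K))
      ≡⟨ cong (N C K +_) (*-distribˡ-+ N (n C k) (n C K)) ⟨
    N C K + N * (n C k + n C K)
      ≡⟨ cong (λ a → N C K + N * a) (nCk+nC[k+1]≡[n+1]C[k+1] n k) ⟩
    suc N * (N C K) ∎
    where
    N = suc n
    K = suc k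

  k!*nCk*[n+1]≡[k+1]!*[n+1]C[k+1] : ∀ n k → k ! * (n C k) * suc n ≡ suc k ! * (suc n C suc k)
  k!*nCk*[n+1]≡[k+1]!*[n+1]C[k+1] n k = begin
    k ! * (n C k) * suc n               ≡⟨ *-assoc (k !) (n C k) (suc n) ⟩
    k ! * ((n C k) * suc n)             ≡⟨ cong (k ! *_) (*-comm (n C k) (suc n)) ⟩
    k ! * (suc n * (n C k))             ≡⟨ cong (k ! *_) ([k+1]*[n+1]C[k+1]≡[n+1]*nCk n k) ⟨
    k ! * (suc k * (suc n C suc k))     ≡⟨ x∙yz≈yx∙z (k !) (suc k) (suc n C suc k) ⟩
    suc k ! * (suc n C suc k)           ∎
    where open import Algebra.Properties.CommutativeSemigroup *-commutativeSemigroup using (x∙yz≈yx∙z)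

module _ {c ℓ : Level} (F : Field c ℓ) where

  open Field F hiding (zero)
  open import Algebra.Properties.Ring ring using (-0#≈0#; -1*x≈-x; [y-z]x≈yx-zx)
  open import Algebra.Properties.Group +-group using (//-rightDividesˡ; //-rightDividesʳ)
  open import Algebra.Properties.CommutativeSemigroup +-commutativeSemigroup
    using (interchange; x∙yz≈y∙xz)
  open import Algebra.Properties.Semiring.Mult semiring using (×-homo-+; ×-homo-1; ×1-homo-*)
  open import Relation.Binary.Reasoning.Setoid setoid
  open import Tactic.RingSolver.Core.AlmostCommutativeRing using (fromCommutativeRing)
  open import Tactic.RingSolver.NonReflective (fromCommutativeRing commutativeRing (λ _ → nothing))
    using (solve; _⊜_; _⊕_; _⊗_; ⊝_)

  private
    infix  4 _≋_
    infixl 7 _⊛_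
    infixr 8 _^_

    _≋_ : FPS F → FPS F → Set ℓ
    _≋_ = _≈ₛ_ F

    _⊛_ : FPS F → FPS F → FPS F
    _⊛_ = _*ₛ_ F

    _^_ : FPS F → ℕ → FPS F
    _^_ = _^ₛ_ F

  x-0≈x : ∀ x → x - 0# ≈ x
  x-0≈x x = trans (+-congˡ -0#≈0#) (+-identityʳ x)

  ι-cong : ∀ {m n} → m ≡ n → ι F m ≈ ι F n
  ι-cong = reflexive ∘ cong (ι F)

  ι-1 : ι F 1 ≈ 1#
  ι-1 = ×-homo-1 1#

  ι-homo-* : ∀ m n → ι F (m ℕ.* n) ≈ ι F m * ι F n
  ι-homo-* = ×1-homo-*

  ι[nC0]≈1 : ∀ n → ι F (n C 0) ≈ 1#
  ι[nC0]≈1 n = trans (ι-cong (nC0≡1 n)) ι-1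

  ι-pascal : ∀ n k → ι F (suc n C suc k) ≈ ι F (n C k) + ι F (n C suc k)
  ι-pascal n k = trans (ι-cong (≡.sym (nCk+nC[k+1]≡[n+1]C[k+1] n k))) (×-homo-+ 1# (n C k) _)

  ι-inverseˡ : CharZero F → ∀ n .{{_ : NonZero n}} → ι F n ⁻¹ * ι F n ≈ 1#
  ι-inverseˡ charZero (suc n) = trans (*-comm _ _) (inverse _ (charZero n))

  sumTo-cong : ∀ n {f g : ℕ → Carrier} → (∀ i → f i ≈ g i) → sumTo F n f ≈ sumTo F n g
  sumTo-cong zero    f≈g = refl
  sumTo-cong (suc n) f≈g = +-cong (sumTo-cong n f≈g) (f≈g n)

  sumTo-sucˡ : ∀ n (f : ℕ → Carrier) → sumTo F (suc n) f ≈ f 0 + sumTo F n (f ∘ suc)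
  sumTo-sucˡ zero    f = trans (+-identityˡ _) (sym (+-identityʳ _))
  sumTo-sucˡ (suc n) f = trans (+-congʳ (sumTo-sucˡ n f)) (+-assoc _ _ _)

  sumTo-0 : ∀ n {f : ℕ → Carrier} → (∀ i → f i ≈ 0#) → sumTo F n f ≈ 0#
  sumTo-0 zero    f≈0 = refl
  sumTo-0 (suc n) f≈0 = trans (+-cong (sumTo-0 n f≈0) (f≈0 n)) (+-identityʳ 0#)

  sumTo-+ : ∀ n (f g : ℕ → Carrier) → sumTo F n (λ i → f i + g i) ≈ sumTo F n f + sumTo F n g
  sumTo-+ zero    f g = sym (+-identityʳ 0#)
  sumTo-+ (suc n) f g = trans (+-congʳ (sumTo-+ n f g)) (interchange _ _ _ _)

  sumTo-sub : ∀ n (f g : ℕ → Carrier) → sumTo F n (λ i → f i - g i) ≈ sumTo F n f - sumTo F n g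
  sumTo-sub zero    f g = sym (-‿inverseʳ 0#)
  sumTo-sub (suc n) f g = trans (+-congʳ (sumTo-sub n f g))
    (solve 4 (λ a b x y → ((a ⊕ ⊝ b) ⊕ (x ⊕ ⊝ y)) ⊜ ((a ⊕ x) ⊕ ⊝ (b ⊕ y)))
             refl _ _ (f n) (g n))

  sumTo-*ʳ : ∀ n (f : ℕ → Carrier) a → sumTo F n (λ i → f i * a) ≈ sumTo F n f * a
  sumTo-*ʳ zero    f a = sym (zeroˡ a)
  sumTo-*ʳ (suc n) f a = trans (+-congʳ (sumTo-*ʳ n f a)) (sym (distribʳ a _ _))

  sumₛ-coeff : ∀ m (G : ℕ → FPS F) n → sumₛ F m G n ≈ sumTo F m (λ j → G j n)
  sumₛ-coeff zero    G n = refl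
  sumₛ-coeff (suc m) G n = +-congʳ (sumₛ-coeff m G n)

  ι-vandermonde : ∀ a b c →
    sumTo F (suc a) (λ j → ι F (a C j) * ι F (b C (c ℕ.+ j))) ≈ ι F ((a ℕ.+ b) C (a ℕ.+ c))
  ι-vandermonde zero    b c = begin
    0# + ι F 1 * ι F (b C (c ℕ.+ 0))  ≈⟨ +-identityˡ _ ⟩
    ι F 1 * ι F (b C (c ℕ.+ 0))       ≈⟨ *-cong ι-1 (ι-cong (cong (b C_) (ℕ.+-identityʳ c))) ⟩
    1# * ι F (b C c)                  ≈⟨ *-identityˡ _ ⟩
    ι F (b C c)                       ∎
  ι-vandermonde (suc a) b c = begin
    sumTo F (suc (suc a)) (λ j → ι F (suc a C j) * B c j)
      ≈⟨ sumTo-sucˡ (suc a) _ ⟩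
    ι F (suc a C 0) * B c 0 + ∑ (λ j → ι F (suc a C suc j) * B c (suc j))
      ≈⟨ +-cong (*-congʳ (trans (ι[nC0]≈1 (suc a)) (sym (ι[nC0]≈1 a))))
                (sumTo-cong (suc a) λ j → trans (*-congʳ (ι-pascal a j)) (distribʳ _ _ _)) ⟩
    A 0 * B c 0 + ∑ (λ j → A j * B c (suc j) + A (suc j) * B c (suc j))
      ≈⟨ +-congˡ (sumTo-+ (suc a) _ _) ⟩
    A 0 * B c 0 + (∑ (λ j → A j * B c (suc j)) + ∑ (λ j → A (suc j) * B c (suc j)))
      ≈⟨ x∙yz≈y∙xz _ _ _ ⟩
    ∑ (λ j → A j * B c (suc j)) + (A 0 * B c 0 + ∑ (λ j → A (suc j) * B c (suc j)))
      ≈⟨ +-cong (sumTo-cong (suc a) λ j → *-congˡ (ι-cong (cong (b C_) (ℕ.+-suc c j))))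
                (sym (sumTo-sucˡ (suc a) (λ j → A j * B c j))) ⟩
    ∑ (λ j → A j * B (suc c) j) + (∑ (λ j → A j * B c j) + A (suc a) * B c (suc a))
      ≈⟨ +-congˡ (+-congˡ (trans (*-congʳ (ι-cong (k>n⇒nCk≡0 (ℕ.n<1+n a)))) (zeroˡ _))) ⟩
    ∑ (λ j → A j * B (suc c) j) + (∑ (λ j → A j * B c j) + 0#)
      ≈⟨ +-cong (ι-vandermonde a b (suc c)) (trans (+-identityʳ _) (ι-vandermonde a b c)) ⟩
    ι F ((a ℕ.+ b) C (a ℕ.+ suc c)) + ι F ((a ℕ.+ b) C (a ℕ.+ c))
      ≈⟨ +-comm _ _ ⟩
    ι F ((a ℕ.+ b) C (a ℕ.+ c)) + ι F ((a ℕ.+ b) C (a ℕ.+ suc c))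
      ≈⟨ +-congˡ (ι-cong (cong ((a ℕ.+ b) C_) (ℕ.+-suc a c))) ⟩
    ι F ((a ℕ.+ b) C (a ℕ.+ c)) + ι F ((a ℕ.+ b) C suc (a ℕ.+ c))
      ≈⟨ ι-pascal (a ℕ.+ b) (a ℕ.+ c) ⟨
    ι F (suc (a ℕ.+ b) C suc (a ℕ.+ c)) ∎
    where
    A : ℕ → Carrier
    A j = ι F (a C j)
    B : ℕ → ℕ → Carrier
    B c j = ι F (b C (c ℕ.+ j))
    ∑ : (ℕ → Carrier) → Carrier
    ∑ = sumTo F (suc a)

  ⊛-congˡ : ∀ {f f′} (g : FPS F) → f ≋ f′ → f ⊛ g ≋ f′ ⊛ g
  ⊛-congˡ g f≋f′ n = sumTo-cong (suc n) (λ i → *-congʳ (f≋f′ i))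

  ⊛-identityˡ : ∀ f → oneₛ F ⊛ f ≋ f
  ⊛-identityˡ f n = begin
    sumTo F (suc n) (λ i → oneₛ F i * f (n ∸ i))
      ≈⟨ sumTo-sucˡ n _ ⟩
    1# * f n + sumTo F n (λ i → 0# * f (n ∸ suc i))
      ≈⟨ +-cong (*-identityˡ (f n)) (sumTo-0 n (λ i → zeroˡ _)) ⟩
    f n + 0#
      ≈⟨ +-identityʳ (f n) ⟩
    f n ∎

  ⊛-coeff-suc : ∀ f g → f 0 ≈ 0# → ∀ n → (f ⊛ g) (suc n) ≈ ((f ∘ suc) ⊛ g) n
  ⊛-coeff-suc f g f₀≈0 n = begin
    (f ⊛ g) (suc n)                            ≈⟨ sumTo-sucˡ (suc n) _ ⟩
    f 0 * g (suc n) + ((f ∘ suc) ⊛ g) n        ≈⟨ +-congʳ (trans (*-congʳ f₀≈0) (zeroˡ _)) ⟩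
    0# + ((f ∘ suc) ⊛ g) n                     ≈⟨ +-identityˡ _ ⟩
    ((f ∘ suc) ⊛ g) n                          ∎

  x^[1+j]-coeff-zero : ∀ j → (Xₛ F ^ suc j) 0 ≈ 0#
  x^[1+j]-coeff-zero j = trans (+-identityˡ _) (zeroˡ _)

  x^[1+j]-coeff-suc : ∀ j n → (Xₛ F ^ suc j) (suc n) ≈ (Xₛ F ^ j) n
  x^[1+j]-coeff-suc j n = begin
    (Xₛ F ^ suc j) (suc n)            ≈⟨ ⊛-coeff-suc (Xₛ F) (Xₛ F ^ j) refl n ⟩
    ((Xₛ F ∘ suc) ⊛ Xₛ F ^ j) n       ≈⟨ ⊛-congˡ (Xₛ F ^ j) x∘suc≋1 n ⟩
    (oneₛ F ⊛ Xₛ F ^ j) n             ≈⟨ ⊛-identityˡ (Xₛ F ^ j) n ⟩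
    (Xₛ F ^ j) n                      ∎
    where
    x∘suc≋1 : Xₛ F ∘ suc ≋ oneₛ F
    x∘suc≋1 zero    = refl
    x∘suc≋1 (suc _) = refl

  x^j⊛-coeff : ∀ j (g φ : FPS F) → (∀ m → g m ≈ φ (j ℕ.+ m)) → (∀ n → n < j → φ n ≈ 0#) →
               Xₛ F ^ j ⊛ g ≋ φ
  x^j⊛-coeff zero    g φ g≈φ _    n = trans (⊛-identityˡ g n) (g≈φ n)
  x^j⊛-coeff (suc j) g φ g≈φ φ<≈0 zero    = begin
    0# + (Xₛ F ^ suc j) 0 * g 0       ≈⟨ +-identityˡ _ ⟩
    (Xₛ F ^ suc j) 0 * g 0            ≈⟨ *-congʳ (x^[1+j]-coeff-zero j) ⟩
    0# * g 0                          ≈⟨ zeroˡ _ ⟩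
    0#                                ≈⟨ φ<≈0 0 (s≤s z≤n) ⟨
    φ 0                               ∎
  x^j⊛-coeff (suc j) g φ g≈φ φ<≈0 (suc n) = begin
    (Xₛ F ^ suc j ⊛ g) (suc n)
      ≈⟨ ⊛-coeff-suc (Xₛ F ^ suc j) g (x^[1+j]-coeff-zero j) n ⟩
    (((Xₛ F ^ suc j) ∘ suc) ⊛ g) n
      ≈⟨ ⊛-congˡ g (x^[1+j]-coeff-suc j) n ⟩
    (Xₛ F ^ j ⊛ g) n
      ≈⟨ x^j⊛-coeff j g (φ ∘ suc) g≈φ (λ m m<j → φ<≈0 (suc m) (s≤s m<j)) n ⟩
    φ (suc n) ∎

  deriv-cong : ∀ {f g} → f ≋ g → deriv F f ≋ deriv F g
  deriv-cong f≋g n = *-congˡ (f≋g (suc n))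

  derivN-suc′ : ∀ k f → derivN F (suc k) f ≋ derivN F k (deriv F f)
  derivN-suc′ zero    f n = refl
  derivN-suc′ (suc k) f   = deriv-cong (derivN-suc′ k f)

  derivN-coeff : ∀ k y m → derivN F k y m ≈ ι F (k ! ℕ.* ((k ℕ.+ m) C k)) * y (k ℕ.+ m)
  derivN-coeff zero    y m = begin
    y m                          ≈⟨ *-identityˡ (y m) ⟨
    1# * y m                     ≈⟨ *-congʳ (trans (ι-cong (ℕ.*-identityˡ (m C 0))) (ι[nC0]≈1 m)) ⟨
    ι F (1 ℕ.* (m C 0)) * y m    ∎
  derivN-coeff (suc k) y m = begin
    derivN F (suc k) y m
      ≈⟨ derivN-suc′ k y m ⟩
    derivN F k (deriv F y) m
      ≈⟨ derivN-coeff k (deriv F y) m ⟩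
    ι F (k ! ℕ.* (N C k)) * (ι F (suc N) * y (suc N))
      ≈⟨ *-assoc _ _ _ ⟨
    ι F (k ! ℕ.* (N C k)) * ι F (suc N) * y (suc N)
      ≈⟨ *-congʳ (ι-homo-* (k ! ℕ.* (N C k)) (suc N)) ⟨
    ι F (k ! ℕ.* (N C k) ℕ.* suc N) * y (suc N)
      ≈⟨ *-congʳ (ι-cong (k!*nCk*[n+1]≡[k+1]!*[n+1]C[k+1] N k)) ⟩
    ι F (suc k ! ℕ.* (suc N C suc k)) * y (suc N)  ∎
    where N = k ℕ.+ m

  x^j⊛derivN[1+j]-coeff : ∀ j y n →
    (Xₛ F ^ j ⊛ derivN F (suc j) y) n ≈ ι F (suc j ! ℕ.* (suc n C suc j)) * y (suc n)
  x^j⊛derivN[1+j]-coeff j y = x^j⊛-coeff j (derivN F (suc j) y) φ (derivN-coeff (suc j) y) φ<j≈0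
    where
    φ : FPS F
    φ n = ι F (suc j ! ℕ.* (suc n C suc j)) * y (suc n)
    φ<j≈0 : ∀ n → n < j → φ n ≈ 0#
    φ<j≈0 n n<j = trans (*-congʳ (ι-cong coeff≡0)) (zeroˡ _)
      where
      coeff≡0 : suc j ! ℕ.* (suc n C suc j) ≡ 0
      coeff≡0 = ≡.trans (cong (suc j ! ℕ.*_) (k>n⇒nCk≡0 (s≤s n<j))) (ℕ.*-zeroʳ (suc j !))

  x^j⊛derivN[1+j]/[1+j]!-coeff : CharZero F → ∀ a j y n →
    (ι F (suc j !) ⁻¹ * a) * (Xₛ F ^ j ⊛ derivN F (suc j) y) n ≈ a * ι F (suc n C suc j) * y (suc n)
  x^j⊛derivN[1+j]/[1+j]!-coeff charZero a j y n = begin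
    (u * a) * (Xₛ F ^ j ⊛ derivN F (suc j) y) n
      ≈⟨ *-congˡ (trans (x^j⊛derivN[1+j]-coeff j y n) (*-congʳ (ι-homo-* (suc j !) _))) ⟩
    (u * a) * ((f * b) * Y)
      ≈⟨ solve 5 (λ u a f b Y → ((u ⊗ a) ⊗ ((f ⊗ b) ⊗ Y)) ⊜ ((u ⊗ f) ⊗ ((a ⊗ b) ⊗ Y)))
                 refl u a f b Y ⟩
    (u * f) * (a * b * Y)
      ≈⟨ *-congʳ (ι-inverseˡ charZero (suc j !) {{ℕ._!≢0 (suc j)}}) ⟩
    1# * (a * b * Y)
      ≈⟨ *-identityˡ _ ⟩
    a * b * Y ∎
    where
    u = ι F (suc j !) ⁻¹
    f = ι F (suc j !)
    b = ι F (suc n C suc j)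
    Y = y (suc n)

  Δ : FPS F → FPS F
  Δ f zero    = f 0
  Δ f (suc n) = f (suc n) - f n

  Δ^ : ℕ → FPS F → FPS F
  Δ^ s f = fold f Δ s

  Δ-cong : ∀ {f g} → f ≋ g → Δ f ≋ Δ g
  Δ-cong f≋g zero    = f≋g 0
  Δ-cong f≋g (suc n) = +-cong (f≋g (suc n)) (-‿cong (f≋g n))

  Δ-injective : ∀ {f g} → Δ f ≋ Δ g → f ≋ g
  Δ-injective         Δf≋Δg zero    = Δf≋Δg 0
  Δ-injective {f} {g} Δf≋Δg (suc n) = begin
    f (suc n)               ≈⟨ //-rightDividesˡ (f n) (f (suc n)) ⟨
    f (suc n) - f n + f n   ≈⟨ +-cong (Δf≋Δg (suc n)) (Δ-injective Δf≋Δg n) ⟩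
    g (suc n) - g n + g n   ≈⟨ //-rightDividesˡ (g n) (g (suc n)) ⟩
    g (suc n)               ∎

  Δ^-cong : ∀ s {f g} → f ≋ g → Δ^ s f ≋ Δ^ s g
  Δ^-cong zero    = id
  Δ^-cong (suc s) = Δ-cong ∘ Δ^-cong s

  Δ^-injective : ∀ s {f g} → Δ^ s f ≋ Δ^ s g → f ≋ g
  Δ^-injective zero    = id
  Δ^-injective (suc s) = Δ^-injective s ∘ Δ-injective

  Δ^-suc′ : ∀ s f → Δ^ (suc s) f ≡ Δ^ s (Δ f)
  Δ^-suc′ s f = ≡.trans (iterate-is-fold f Δ (suc s)) (≡.sym (iterate-is-fold (Δ f) Δ s))

  [1-x]⊛f≋Δf : ∀ f → oneMinusX F ⊛ f ≋ Δ f
  [1-x]⊛f≋Δf f zero    = trans (+-identityˡ _) (*-identityˡ (f 0))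
  [1-x]⊛f≋Δf f (suc n) = begin
    (oneMinusX F ⊛ f) (suc n)
      ≈⟨ sumTo-sucˡ (suc n) _ ⟩
    1# * f (suc n) + sumTo F (suc n) (λ i → oneMinusX F (suc i) * f (n ∸ i))
      ≈⟨ +-congˡ (sumTo-sucˡ n _) ⟩
    1# * f (suc n) + (- 1# * f n + sumTo F n (λ i → 0# * f (n ∸ suc i)))
      ≈⟨ +-cong (*-identityˡ _) (+-cong (-1*x≈-x (f n)) (sumTo-0 n (λ _ → zeroˡ _))) ⟩
    f (suc n) + (- f n + 0#)
      ≈⟨ +-congˡ (+-identityʳ _) ⟩
    f (suc n) - f n ∎

  Δf⊛g≋Δ[f⊛g] : ∀ f g → Δ f ⊛ g ≋ Δ (f ⊛ g)
  Δf⊛g≋Δ[f⊛g] f g zero    = refl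
  Δf⊛g≋Δ[f⊛g] f g (suc n) = begin
    (Δ f ⊛ g) (suc n)
      ≈⟨ sumTo-sucˡ (suc n) _ ⟩
    f 0 * g (suc n) + sumTo F (suc n) (λ i → (f (suc i) - f i) * g (n ∸ i))
      ≈⟨ +-congˡ (sumTo-cong (suc n) (λ i → [y-z]x≈yx-zx _ _ _)) ⟩
    f 0 * g (suc n) + sumTo F (suc n) (λ i → f (suc i) * g (n ∸ i) - f i * g (n ∸ i))
      ≈⟨ +-congˡ (sumTo-sub (suc n) _ _) ⟩
    f 0 * g (suc n) + (((f ∘ suc) ⊛ g) n - (f ⊛ g) n)
      ≈⟨ +-assoc _ _ _ ⟨
    f 0 * g (suc n) + ((f ∘ suc) ⊛ g) n - (f ⊛ g) n
      ≈⟨ +-congʳ (sumTo-sucˡ (suc n) _) ⟨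
    (f ⊛ g) (suc n) - (f ⊛ g) n ∎

  [1-x]^s⊛f≋Δ^sf : ∀ s f → oneMinusX F ^ s ⊛ f ≋ Δ^ s f
  [1-x]^s⊛f≋Δ^sf zero    f   = ⊛-identityˡ f
  [1-x]^s⊛f≋Δ^sf (suc s) f n = begin
    (oneMinusX F ^ suc s ⊛ f) n   ≈⟨ ⊛-congˡ f ([1-x]⊛f≋Δf (oneMinusX F ^ s)) n ⟩
    (Δ (oneMinusX F ^ s) ⊛ f) n   ≈⟨ Δf⊛g≋Δ[f⊛g] (oneMinusX F ^ s) f n ⟩
    Δ (oneMinusX F ^ s ⊛ f) n     ≈⟨ Δ-cong ([1-x]^s⊛f≋Δ^sf s f) n ⟩
    Δ^ (suc s) f n                ∎

  x/[1-x]^suc : ℕ → FPS F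
  x/[1-x]^suc t zero    = 0#
  x/[1-x]^suc t (suc n) = ι F ((n ℕ.+ t) C t)

  Δ[x/[1-x]]≋x : Δ (x/[1-x]^suc 0) ≋ Xₛ F
  Δ[x/[1-x]]≋x zero          = refl
  Δ[x/[1-x]]≋x (suc zero)    = trans (x-0≈x _) (ι[nC0]≈1 0)
  Δ[x/[1-x]]≋x (suc (suc n)) =
    trans (+-cong (ι[nC0]≈1 (suc n ℕ.+ 0)) (-‿cong (ι[nC0]≈1 (n ℕ.+ 0)))) (-‿inverseʳ 1#)

  Δ-x/[1-x]^suc : ∀ t → Δ (x/[1-x]^suc (suc t)) ≋ x/[1-x]^suc t
  Δ-x/[1-x]^suc t zero          = refl
  Δ-x/[1-x]^suc t (suc zero)    = trans (x-0≈x _) (ι-cong (≡.trans (nCn≡1 (suc t)) (≡.sym (nCn≡1 t))))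
  Δ-x/[1-x]^suc t (suc (suc n)) = begin
    ι F (suc M C suc t) - ι F (M C suc t)                 ≈⟨ +-congʳ (ι-pascal M t) ⟩
    ι F (M C t) + ι F (M C suc t) - ι F (M C suc t)       ≈⟨ //-rightDividesʳ _ _ ⟩
    ι F (M C t)                                           ≈⟨ ι-cong (cong (_C t) (ℕ.+-suc n t)) ⟩
    ι F ((suc n ℕ.+ t) C t)                               ∎
    where M = n ℕ.+ suc t

  Δ^[1+t]-x/[1-x]^suc : ∀ t → Δ^ (suc t) (x/[1-x]^suc t) ≋ Xₛ F
  Δ^[1+t]-x/[1-x]^suc zero      = Δ[x/[1-x]]≋x
  Δ^[1+t]-x/[1-x]^suc (suc t) n = begin
    Δ^ (suc (suc t)) (x/[1-x]^suc (suc t)) n  ≡⟨ ≡.cong-app (Δ^-suc′ (suc t) _) n ⟩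
    Δ^ (suc t) (Δ (x/[1-x]^suc (suc t))) n    ≈⟨ Δ^-cong (suc t) (Δ-x/[1-x]^suc t) n ⟩
    Δ^ (suc t) (x/[1-x]^suc t) n              ≈⟨ Δ^[1+t]-x/[1-x]^suc t n ⟩
    Xₛ F n                                    ∎

  x/[1-x]^suc-unique : ∀ t h → oneMinusX F ^ suc t ⊛ h ≋ Xₛ F → h ≋ x/[1-x]^suc t
  x/[1-x]^suc-unique t h [1-x]^[1+t]⊛h≋x = Δ^-injective (suc t) λ n → begin
    Δ^ (suc t) h n                    ≈⟨ [1-x]^s⊛f≋Δ^sf (suc t) h n ⟨
    (oneMinusX F ^ suc t ⊛ h) n       ≈⟨ [1-x]^[1+t]⊛h≋x n ⟩
    Xₛ F n                            ≈⟨ Δ^[1+t]-x/[1-x]^suc t n ⟨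
    Δ^ (suc t) (x/[1-x]^suc t) n      ∎

mainTheorem10 : ∀ {c ℓ : Level} (F : Field c ℓ) → CharZero F →
    (s : ℕ) → 2 ≤ s →
    -- h is h_s = x / (1 - x)^s, i.e. the series with (1 - x)^s · h = x
    (h : FPS F) → _≈ₛ_ F (_*ₛ_ F (_^ₛ_ F (oneMinusX F) s) h) (Xₛ F) →
    (y : FPS F) →
    _≈ₛ_ F (hDeriv F h y)
      (sumₛ F (s ∸ 1) (λ j →
        -- term for k = j + 1 (k ranges over 1 .. s-1)
        _·ₛ_ F (Field._*_ F (Field._⁻¹ F (ι F (suc j !))) (ι F ((s ∸ 2) C j)))
          (_*ₛ_ F (_^ₛ_ F (Xₛ F) j) (derivN F (suc j) y))))
mainTheorem10 F charZero (suc (suc r)) (s≤s (s≤s _)) h [1-x]^s⊛h≋x y n = begin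
  h (suc n) * y (suc n)
    ≈⟨ *-congʳ (x/[1-x]^suc-unique F (suc r) h [1-x]^s⊛h≋x (suc n)) ⟩
  ι F ((n ℕ.+ suc r) C suc r) * y (suc n)
    ≈⟨ *-congʳ (ι-cong F (cong₂ _C_ n+[1+r]≡r+[1+n] (ℕ.+-comm 1 r))) ⟩
  ι F ((r ℕ.+ suc n) C (r ℕ.+ 1)) * y (suc n)
    ≈⟨ *-congʳ (ι-vandermonde F r (suc n) 1) ⟨
  sumTo F (suc r) (λ j → ι F (r C j) * ι F (suc n C suc j)) * y (suc n)
    ≈⟨ sumTo-*ʳ F (suc r) _ (y (suc n)) ⟨
  sumTo F (suc r) (λ j → ι F (r C j) * ι F (suc n C suc j) * y (suc n))
    ≈⟨ sumTo-cong F (suc r) (λ j → x^j⊛derivN[1+j]/[1+j]!-coeff F charZero (ι F (r C j)) j y n) ⟨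
  sumTo F (suc r) (λ j → summand j n)
    ≈⟨ sumₛ-coeff F (suc r) summand n ⟨
  sumₛ F (suc r) summand n ∎
  where
  open Field F
  open import Relation.Binary.Reasoning.Setoid setoid
  n+[1+r]≡r+[1+n] : n ℕ.+ suc r ≡ r ℕ.+ suc n
  n+[1+r]≡r+[1+n] = ≡.trans (ℕ.+-comm n (suc r)) (≡.sym (ℕ.+-suc r n))
  summand : ℕ → FPS F
  summand j = _·ₛ_ F (ι F (suc j !) ⁻¹ * ι F (r C j)) (_*ₛ_ F (_^ₛ_ F (Xₛ F) j) (derivN F (suc j) y))
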